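{- Let $\mu,\nu,\lambda$ be polynomial dominant weights of $GL_n$, let $H\in\mathcal{H}(\mu,\nu,\lambda)$, and let $T_1(H)$, $T_2(H)$ be its derived $t$-arrays. Then $T_1(H)$ satisfies IC(2) if and only if $T_2(H)$ satisfies IC(1).
   Context: A polynomial dominant weight of $GL_n$ is a sequence of nonnegative integers $(\mu_1,\dots,\mu_n)$ with $\mu_1\ge\dots\ge\mu_n$. A $t$-array is an integer array $T=(t^{(i)}_j)_{1\le j\le i\le n}$. It satisfies IC(1) if $t^{(i+1)}_j\ge t^{(i)}_j$ for all $1\le j\le i\le n-1$, and IC(2) if $t^{(i)}_j\ge t^{(i+1)}_{j+1}$ for all $1\le j\le i\le n-1$. An $h$-array is an array of nonnegative integers $H=(h_{a,b})_{0\le a\le b\le n}$ with $h_{0,0}=0$; $\mathcal{H}(\mu,\nu,\lambda)$ is the set of $h$-arrays with $h_{0,i}=\mu_1+\dots+\mu_i$, $h_{i,n}=\sum_{j=1}^n\mu_j+\nu_1+\dots+\nu_i$, $h_{i,i}=\lambda_1+\dots+\lambda_i$ for $1\le i\le n$. The derived $t$-arrays $T_1(H)=(x^{(i)}_j)$, $T_2(H)=(y^{(i)}_j)$ are defined, for $0\le a\le b\le n-1$, by $x^{(n-a)}_{b+1-a}=h_{a,b+1}-h_{a,b}$ and $y^{(b+1)}_{a+1}=h_{a+1,b+1}-h_{a,b+1}$. -}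

module Defs where

open import Data.Nat using (ℕ; zero; suc; _+_; _∸_; _≤_; _<_)
open import Data.Integer using (ℤ; _-_; +_)
import Data.Integer as ℤ
open import Data.Product using (_×_)
open import Relation.Binary.PropositionalEquality using (_≡_)

-- Sequences/arrays are functions on ℕ; only the indices in the stated
-- ranges are ever inspected (weights are indexed 1..n, h-arrays by
-- 0 ≤ a ≤ b ≤ n, t-arrays by 1 ≤ j ≤ i ≤ n).

-- polynomial dominant weight of GL_n: nonnegative (ℕ-valued), μ₁ ≥ … ≥ μₙ
Dominant : ℕ → (ℕ → ℕ) → Set
Dominant n μ = ∀ i → 1 ≤ i → i < n → μ (suc i) ≤ μ i

psum : (ℕ → ℕ) → ℕ → ℕ
psum μ zero    = 0
psum μ (suc i) = psum μ i + μ (suc i)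

HArray : Set
HArray = ℕ → ℕ → ℕ

InH : ℕ → (μ ν λ' : ℕ → ℕ) → HArray → Set
InH n μ ν λ' h =
  (h 0 0 ≡ 0) ×
  (∀ i → 1 ≤ i → i ≤ n →
     (h 0 i ≡ psum μ i) ×
     (h i n ≡ psum μ n + psum ν i) ×
     (h i i ≡ psum λ' i))

-- a t-array : t i j = t^{(i)}_j for 1 ≤ j ≤ i ≤ n
TArray : Set
TArray = ℕ → ℕ → ℤ

IC1 : ℕ → TArray → Set
IC1 n t = ∀ i j → 1 ≤ j → j ≤ i → i ≤ n ∸ 1 → t i j ℤ.≤ t (suc i) j

IC2 : ℕ → TArray → Set
IC2 n t = ∀ i j → 1 ≤ j → j ≤ i → i ≤ n ∸ 1 → t (suc i) (suc j) ℤ.≤ t i j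

-- derived t-arrays.
-- x^{(n-a)}_{b+1-a} = h_{a,b+1} - h_{a,b}  (0 ≤ a ≤ b ≤ n-1); solving for
-- (a,b) from (i,j) = (n-a, b+1-a):  a = n-i,  b = n-i+j-1.
T₁ : ℕ → HArray → TArray
T₁ n h i j = + h (n ∸ i) (n ∸ i + j) - + h (n ∸ i) (n ∸ i + j ∸ 1)

-- y^{(b+1)}_{a+1} = h_{a+1,b+1} - h_{a,b+1}; with (i,j) = (b+1,a+1):
T₂ : HArray → TArray
T₂ h i j = + h j i - + h (j ∸ 1) i

module Submission where

-- Both conditions of the proposition are reformulations of one and the
-- same family of "rhombus inequalities" on the h-array,
--
--     h(a, b+1) + h(a+1, b)  ≤  h(a+1, b+1) + h(a, b)      (0 ≤ a < b ≤ n-1),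
--
-- saying that going once right and once down in h costs at least as much
-- along the diagonal as along the anti-diagonal.  An inequality between
-- two differences  p - q ≤ r - s  is equivalent to  p + s ≤ r + q
-- ('difference-≤⇔'), so
--   * IC(1) for T₂(H) at the entry (i, j) = (b, a+1) is the rhombus
--     inequality at (a, b)  ('T₂-step⇔Rhombus', 'IC1-T₂⇔Rhombi'), and
--   * IC(2) for T₁(H) at the entry (i, j) = (n-1-a, b-a) is the rhombus
--     inequality at (a, b)  ('T₁-step⇔Rhombus', 'IC2-T₁⇔Rhombi');
-- the proposition follows by composing the two equivalences.

open import Defs
open import Data.Nat using (ℕ; zero; suc; _+_; _∸_; _≤_; _<_; s≤s; z≤n)
import Data.Nat.Properties as ℕ
open import Data.Integer using (+_; _-_)
import Data.Integer as ℤ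
import Data.Integer.Properties as ℤₚ
open import Data.Integer.Solver using (module +-*-Solver)
open import Data.Empty using (⊥-elim)
open import Function.Bundles using (_⇔_; mk⇔; module Equivalence)
import Function.Properties.Equivalence as ⇔
open import Relation.Binary.PropositionalEquality
  using (_≡_; refl; sym; trans; cong; subst; subst₂)

difference-≤⇔ : ∀ p q r s → (+ p - + q ℤ.≤ + r - + s) ⇔ (p + s ≤ r + q)
difference-≤⇔ p q r s = mk⇔ to from
  where
  open +-*-Solver
  clearˡ : + p - + q ℤ.+ (+ q ℤ.+ + s) ≡ + (p + s)
  clearˡ = trans (solve 3 (λ p q s → p :- q :+ (q :+ s) := p :+ s) refl (+ p) (+ q) (+ s))
                 (sym (ℤₚ.pos-+ p s))
  clearʳ : + r - + s ℤ.+ (+ q ℤ.+ + s) ≡ + (r + q)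
  clearʳ = trans (solve 3 (λ r q s → r :- s :+ (q :+ s) := r :+ q) refl (+ r) (+ q) (+ s))
                 (sym (ℤₚ.pos-+ r q))
  restoreˡ : + (p + s) ℤ.+ (ℤ.- (+ q ℤ.+ + s)) ≡ + p - + q
  restoreˡ rewrite ℤₚ.pos-+ p s =
    solve 3 (λ p q s → p :+ s :+ (:- (q :+ s)) := p :- q) refl (+ p) (+ q) (+ s)
  restoreʳ : + (r + q) ℤ.+ (ℤ.- (+ q ℤ.+ + s)) ≡ + r - + s
  restoreʳ rewrite ℤₚ.pos-+ r q =
    solve 3 (λ r q s → r :+ q :+ (:- (q :+ s)) := r :- s) refl (+ r) (+ q) (+ s)

  to : + p - + q ℤ.≤ + r - + s → p + s ≤ r + q
  to le = ℤₚ.drop‿+≤+ (subst₂ ℤ._≤_ clearˡ clearʳ (ℤₚ.+-monoˡ-≤ (+ q ℤ.+ + s) le))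

  from : p + s ≤ r + q → + p - + q ℤ.≤ + r - + s
  from le = subst₂ ℤ._≤_ restoreˡ restoreʳ (ℤₚ.+-monoˡ-≤ (ℤ.- (+ q ℤ.+ + s)) (ℤ.+≤+ le))

Rhombus : HArray → ℕ → ℕ → Set
Rhombus h a b = h a (suc b) + h (suc a) b ≤ h (suc a) (suc b) + h a b

Rhombi : ℕ → HArray → Set
Rhombi n h = ∀ a b → a < b → b ≤ n ∸ 1 → Rhombus h a b

T₂-step⇔Rhombus : ∀ h a b → (T₂ h b (suc a) ℤ.≤ T₂ h (suc b) (suc a)) ⇔ Rhombus h a b
T₂-step⇔Rhombus h a b = mk⇔
  (λ le → subst (_≤ h (suc a) (suc b) + h a b) (ℕ.+-comm (h (suc a) b) (h a (suc b))) (to le))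
  (λ le → from (subst (_≤ h (suc a) (suc b) + h a b) (ℕ.+-comm (h a (suc b)) (h (suc a) b)) le))
  where
  open Equivalence (difference-≤⇔ (h (suc a) b) (h a b) (h (suc a) (suc b)) (h a (suc b)))

IC1-T₂⇔Rhombi : ∀ n h → IC1 n (T₂ h) ⇔ Rhombi n h
IC1-T₂⇔Rhombi n h = mk⇔
  (λ ic a b a<b b≤ → to (T₂-step⇔Rhombus h a b) (ic b (suc a) (s≤s z≤n) a<b b≤))
  (λ { rh b (suc a) _ a<b b≤ → from (T₂-step⇔Rhombus h a b) (rh a b a<b b≤) })
  where open Equivalence

T₁-step⇔Rhombus : ∀ m h i k → i ≤ m →
  (T₁ (suc m) h (suc i) (suc (suc k)) ℤ.≤ T₁ (suc m) h i (suc k))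
    ⇔ Rhombus h (m ∸ i) (suc (m ∸ i + k))
T₁-step⇔Rhombus m h i k i≤m =
  subst₂ (λ x y → (x ℤ.≤ y) ⇔ Rhombus h a b) (sym lower) (sym upper)
    (difference-≤⇔ (h a (suc b)) (h a b) (h (suc a) (suc b)) (h (suc a) b))
  where
  a = m ∸ i
  b = suc (a + k)
  -- row n - (i+1) of h is row a, row n - i is row a + 1
  lower : T₁ (suc m) h (suc i) (suc (suc k)) ≡ + h a (suc b) - + h a b
  lower rewrite ℕ.+-suc a (suc k) | ℕ.+-suc a k = refl
  upper : T₁ (suc m) h i (suc k) ≡ + h (suc a) (suc b) - + h (suc a) b
  upper rewrite ℕ.+-∸-assoc 1 i≤m | ℕ.+-suc a k = refl

IC2-T₁⇔Rhombi : ∀ n h → IC2 n (T₁ n h) ⇔ Rhombi n h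
IC2-T₁⇔Rhombi zero h = mk⇔
  (λ _ a b a<b b≤0 → ⊥-elim (ℕ.n≮0 (ℕ.<-≤-trans a<b b≤0)))
  (λ _ i j 1≤j j≤i i≤0 → ⊥-elim (ℕ.n≮0 (ℕ.≤-trans 1≤j (ℕ.≤-trans j≤i i≤0))))
IC2-T₁⇔Rhombi (suc m) h = mk⇔ rhombi ic2
  where
  open Equivalence

  rhombi : IC2 (suc m) (T₁ (suc m) h) → Rhombi (suc m) h
  rhombi ic a b a<b b≤m = subst₂ (Rhombus h) (ℕ.m∸[m∸n]≡n a≤m) b-corner
      (to (T₁-step⇔Rhombus m h (m ∸ a) k (ℕ.m∸n≤m m a))
          (ic (m ∸ a) (suc k) (s≤s z≤n) k<m∸a (ℕ.m∸n≤m m a)))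
    where
    k = b ∸ suc a
    a≤m : a ≤ m
    a≤m = ℕ.≤-trans (ℕ.n≤1+n a) (ℕ.≤-trans a<b b≤m)
    k<m∸a : k < m ∸ a
    k<m∸a = subst (_≤ m ∸ a) (ℕ.+-∸-assoc 1 a<b) (ℕ.∸-monoˡ-≤ a b≤m)
    b-corner : suc (m ∸ (m ∸ a) + k) ≡ b
    b-corner = trans (cong (λ c → suc (c + k)) (ℕ.m∸[m∸n]≡n a≤m)) (ℕ.m+[n∸m]≡n a<b)

  ic2 : Rhombi (suc m) h → IC2 (suc m) (T₁ (suc m) h)
  ic2 rh i (suc k) _ k<i i≤m =
    from (T₁-step⇔Rhombus m h i k i≤m) (rh (m ∸ i) (suc (m ∸ i + k)) (s≤s (ℕ.m≤m+n _ k)) b≤m)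
    where
    b≤m : suc (m ∸ i + k) ≤ m
    b≤m = subst (suc (m ∸ i + k) ≤_) (ℕ.m∸n+n≡m i≤m) (ℕ.+-monoʳ-< (m ∸ i) k<i)

proposition3p5 : (n : ℕ) (μ ν λ' : ℕ → ℕ) →
    Dominant n μ → Dominant n ν → Dominant n λ' →
    (h : HArray) → InH n μ ν λ' h →
    IC2 n (T₁ n h) ⇔ IC1 n (T₂ h)
proposition3p5 n _ _ _ _ _ _ h _ =
  ⇔.trans (IC2-T₁⇔Rhombi n h) (⇔.sym (IC1-T₂⇔Rhombi n h))
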